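{- Let $k,\Delta\geq 2$ with $\Delta\leq k$, and let $T$ be any $[\Delta,k]$-transversal design. Let $U$ be any block of $T$ and let $t_1,t_2,\ldots,t_\Delta$ be any $\Delta$ nodes of $T$ (repetitions allowed). Then there are paths $\pi_1,\ldots,\pi_\Delta$ in $T$, where $\pi_i$ goes from $U$ to $t_i$ and has length at most $7$, such that $\pi_1,\ldots,\pi_\Delta$ are pairwise internally-disjoint.
   Context: A $[\Delta,k]$-transversal design ($k,\Delta\ge2$) is a set of $\Delta k$ elements partitioned into $\Delta$ groups of size $k$, with a family of $k^2$ blocks, each a $\Delta$-subset meeting every group in exactly one element, such that every pair of elements from distinct groups lies in exactly one block. It is viewed as a bipartite graph with the elements as nodes, the blocks as blocks, and a node adjacent to a block iff it belongs to it. A path is a sequence of distinct vertices with consecutive ones adjacent; its length is its number of edges. A set of paths is pairwise internally-disjoint if every source or destination appears only as a source or destination of paths in the set, and every other vertex appears on at most one of the paths. -}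

module Defs where

open import Data.Nat using (ℕ; _*_; _+_; _≤_)
open import Data.Fin using (Fin)
open import Data.Product using (Σ; _×_; _,_; ∃)
open import Data.Sum using (_⊎_; inj₁; inj₂)
open import Data.Empty using (⊥)
open import Data.List using (List; _∷_; []; _++_; [_]; length)
open import Data.List.Membership.Propositional using (_∈_)
open import Data.List.Relation.Unary.Linked using (Linked)
open import Data.List.Relation.Unary.Unique.Propositional using (Unique)
open import Relation.Binary.PropositionalEquality using (_≡_; _≢_)

-- Elements of a [Δ,k]-transversal design: the Δ groups are indexed by
-- Fin Δ and the k elements of each group by Fin k, so an element is a
-- pair (group , position in group).
Node : ℕ → ℕ → Set
Node Δ k = Fin Δ × Fin k

-- A [Δ,k]-transversal design: a family of k² blocks; a block meets every
-- group in exactly one element, so it is given by the function sending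
-- each group g to the (index of the) unique element of g in the block.
record TD (Δ k : ℕ) : Set where
  field
    block : Fin (k * k) → Fin Δ → Fin k
    pair-exists : ∀ (g g′ : Fin Δ) → g ≢ g′ → ∀ (a a′ : Fin k) →
      ∃ λ b → (block b g ≡ a) × (block b g′ ≡ a′)
    pair-unique : ∀ (g g′ : Fin Δ) → g ≢ g′ → ∀ (a a′ : Fin k) →
      ∀ b b′ → block b g ≡ a → block b g′ ≡ a′ →
      block b′ g ≡ a → block b′ g′ ≡ a′ → b ≡ b′

open TD public

Vertex : ℕ → ℕ → Set
Vertex Δ k = Node Δ k ⊎ Fin (k * k)

Adj : ∀ {Δ k} → TD Δ k → Vertex Δ k → Vertex Δ k → Set
Adj T (inj₁ (g , a)) (inj₂ b) = block T b g ≡ a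
Adj T (inj₂ b) (inj₁ (g , a)) = block T b g ≡ a
Adj T (inj₁ _) (inj₁ _) = ⊥
Adj T (inj₂ _) (inj₂ _) = ⊥

-- A path from s to t: the vertex sequence s ∷ mid ++ [ t ], with all
-- vertices distinct and consecutive vertices adjacent.
-- Its internal vertices are exactly the elements of mid.
record Path {Δ k} (T : TD Δ k) (s t : Vertex Δ k) : Set where
  field
    mid : List (Vertex Δ k)
    distinct : Unique (s ∷ mid ++ [ t ])
    adjacent : Linked (Adj T) (s ∷ mid ++ [ t ])

open Path public

vertices : ∀ {Δ k} {T : TD Δ k} {s t} → Path T s t → List (Vertex Δ k)
vertices {s = s} {t} p = s ∷ mid p ++ [ t ]

-- Length = number of edges = number of vertices minus one.
pathLength : ∀ {Δ k} {T : TD Δ k} {s t} → Path T s t → ℕ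
pathLength p = length (mid p) + 1

InternallyDisjoint : ∀ {Δ k} {T : TD Δ k} {n : ℕ}
  (src dst : Fin n → Vertex Δ k) → ((i : Fin n) → Path T (src i) (dst i)) → Set
InternallyDisjoint {n = n} src dst π =
  (∀ (i j : Fin n) (v : Vertex _ _) → v ∈ mid (π j) → (v ≢ src i) × (v ≢ dst i))
  × (∀ (i j : Fin n) → i ≢ j → ∀ (v : Vertex _ _) → v ∈ mid (π i) → v ∈ mid (π j) → ⊥)

-- A target on the block U is joined to U by a single edge.  Every other target t
-- enters U through the node u that U has in some group G containing no target node
-- of U; such groups are at least as many as the targets off U, because each group
-- whose U-node is a target is the group of a target on U.  If G is not the group
-- of t, then U – u – B – t with B the block through u and t.  Otherwise the path
-- is U – u – C – w – D – t, where D is a block through t missing U altogether: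
-- if each of the k blocks through t and a node of a fixed other group met U, they
-- would do so in pairwise distinct groups other than that of t, of which there
-- are only Δ − 1 < k.
-- The entry groups are chosen injectively and different from the group of the
-- target unless all targets off U lie in one group, so at most one path of the
-- second kind occurs.  Every internal block then meets U exactly at the entry
-- group of its path or misses U, and every internal node is the entry node of its
-- path or lies off U, which makes distinct paths internally disjoint.
module Submission where

open import Defs
open import Data.Nat using (ℕ; suc; _+_; _*_; _≤_; z≤n; s≤s)
open import Data.Nat.Properties
  using (≤-trans; ≤-pred; +-suc; m≤m+n; +-cancelˡ-≤; +-monoˡ-≤; module ≤-Reasoning)
open import Data.Fin using (Fin; zero; punchIn; punchOut)
open import Data.Fin.Properties using (pigeonhole; punchOut-injective; punchInᵢ≢i)
  renaming (_≟_ to _≟ᶠ_; any? to anyᶠ?; <-irrefl to <ᶠ-irrefl)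
open import Data.List using (List; []; _∷_; length; filter; map; allFin)
open import Data.List.Properties using (filter-notAll; length-map)
open import Data.List.Membership.Propositional using (_∈_; _∉_; find)
open import Data.List.Membership.Propositional.Properties
  using (∈-filter⁺; ∈-filter⁻; ∈-map⁺; ∈-allFin)
import Data.List.Membership.DecPropositional as DecMembership
open import Data.List.Relation.Binary.Subset.Propositional using (_⊆_)
open import Data.List.Relation.Unary.All as All using (All; []; _∷_; all?)
open import Data.List.Relation.Unary.All.Properties using (¬All⇒Any¬)
open import Data.List.Relation.Unary.Any as Any using (here; there)
open import Data.List.Relation.Unary.AllPairs using ([]; _∷_)
open import Data.List.Relation.Unary.Linked using ([-]; _∷_)
open import Data.List.Relation.Unary.Unique.Propositional using (Unique)
import Data.List.Relation.Unary.Unique.Propositional.Properties as Unique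
open import Data.Product using (Σ; ∃; _×_; _,_; proj₁; proj₂)
open import Data.Product.Properties using (≡-dec)
open import Data.Sum using (_⊎_; inj₁; inj₂)
open import Data.Sum.Properties using (inj₁-injective; inj₂-injective)
open import Data.Empty using (⊥; ⊥-elim)
open import Function using (_∘_)
open import Relation.Nullary using (¬_; Dec; yes; no; ¬?; contradiction)
open import Relation.Nullary.Decidable using (decidable-stable)
open import Relation.Unary using (Decidable)
open import Relation.Unary.Properties using (∁?)
open import Relation.Binary.Definitions using (DecidableEquality)
open import Relation.Binary.PropositionalEquality
  using (_≡_; _≢_; refl; sym; trans; cong; subst; module ≡-Reasoning)

length-filter-∁ : ∀ {A : Set} {P : A → Set} (P? : Decidable P) xs →
  length (filter P? xs) + length (filter (∁? P?) xs) ≡ length xs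
length-filter-∁ P? [] = refl
length-filter-∁ P? (x ∷ xs) with P? x
... | yes _ = cong suc (length-filter-∁ P? xs)
... | no _ = trans (+-suc _ _) (cong suc (length-filter-∁ P? xs))

module Removal {G : Set} (_≟_ : DecidableEquality G) where

  remove : G → List G → List G
  remove f = filter (λ x → ¬? (x ≟ f))

  ∈-remove⁻ : ∀ {f x} xs → x ∈ remove f xs → x ∈ xs × x ≢ f
  ∈-remove⁻ xs = ∈-filter⁻ _ {xs = xs}

  ∈-remove⁺ : ∀ {f x xs} → x ∈ xs → x ≢ f → x ∈ remove f xs
  ∈-remove⁺ = ∈-filter⁺ _

  remove-unique : ∀ {f xs} → Unique xs → Unique (remove f xs)
  remove-unique = Unique.filter⁺ _

  length-remove< : ∀ {f xs} → f ∈ xs → suc (length (remove f xs)) ≤ length xs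
  length-remove< {xs = xs} f∈xs =
    filter-notAll _ xs (Any.map (λ f≡x x≢f → x≢f (sym f≡x)) f∈xs)

  Unique-⊆⇒length≤ : ∀ {xs ys} → Unique xs → xs ⊆ ys → length xs ≤ length ys
  Unique-⊆⇒length≤ {[]} _ _ = z≤n
  Unique-⊆⇒length≤ {x ∷ xs} {ys} (x∉xs ∷ u) xs⊆ys =
    ≤-trans (s≤s (Unique-⊆⇒length≤ u xs⊆ys-x)) (length-remove< (xs⊆ys (here refl)))
    where
    xs⊆ys-x : xs ⊆ remove x ys
    xs⊆ys-x y∈xs =
      ∈-remove⁺ (xs⊆ys (there y∈xs)) (λ y≡x → All.lookup x∉xs y∈xs (sym y≡x))

  length≤suc-remove : ∀ {f xs} → Unique xs → length xs ≤ suc (length (remove f xs))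
  length≤suc-remove {f} u = Unique-⊆⇒length≤ u xs⊆f∷xs-f
    where
    xs⊆f∷xs-f : ∀ {x xs} → x ∈ xs → x ∈ f ∷ remove f xs
    xs⊆f∷xs-f {x} x∈xs with x ≟ f
    ... | yes x≡f = here x≡f
    ... | no x≢f = there (∈-remove⁺ x∈xs x≢f)

module Assignment {A G : Set} (_≟_ : DecidableEquality G) (forbidden : A → G) where
  open Removal _≟_
  open DecMembership _≟_ using (_∈?_)

  record Injection (S : List A) (F : List G) : Set where
    field
      value : ∀ {s} → s ∈ S → G
      value∈ : ∀ {s} (p : s ∈ S) → value p ∈ F
      value-injective : ∀ {s s′} (p : s ∈ S) (q : s′ ∈ S) → value p ≡ value q → s ≡ s′

  open Injection public

  Avoiding : ∀ {S F} → Injection S F → Set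
  Avoiding {S} σ = ∀ {s} (p : s ∈ S) → value σ p ≢ forbidden s

  Uniform : List A → Set
  Uniform S = ∃ λ g → All (λ s → forbidden s ≡ g) S

  Assigned : List A → List G → Set
  Assigned S F = Σ (Injection S F) λ σ → Avoiding σ ⊎ Uniform S

  empty : ∀ {F} → Injection [] F
  empty = record { value = λ () ; value∈ = λ () ; value-injective = λ () }

  extend : ∀ {s S f F} → f ∈ F → Injection S (remove f F) → Injection (s ∷ S) F
  extend {f = f} {F} f∈F σ = record { value = val ; value∈ = val∈ ; value-injective = val-inj }
    where
    val : ∀ {x} → x ∈ _ → G
    val (here _) = f
    val (there p) = value σ p
    val∈ : ∀ {x} (p : x ∈ _) → val p ∈ F
    val∈ (here _) = f∈F
    val∈ (there p) = proj₁ (∈-remove⁻ F (value∈ σ p))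
    val-inj : ∀ {x y} (p : x ∈ _) (q : y ∈ _) → val p ≡ val q → x ≡ y
    val-inj (here x≡s) (here y≡s) _ = trans x≡s (sym y≡s)
    val-inj (here _) (there q) f≡σq = ⊥-elim (proj₂ (∈-remove⁻ F (value∈ σ q)) (sym f≡σq))
    val-inj (there p) (here _) σp≡f = ⊥-elim (proj₂ (∈-remove⁻ F (value∈ σ p)) σp≡f)
    val-inj (there p) (there q) = value-injective σ p q

  extend-avoiding : ∀ {s S f F} (f∈F : f ∈ F) {σ : Injection S (remove f F)} →
    f ≢ forbidden s → Avoiding σ → Avoiding (extend {s} f∈F σ)
  extend-avoiding _ f≢s _ (here refl) = f≢s
  extend-avoiding _ _ σ-avoids (there p) = σ-avoids p

  avoiding-if-unused : ∀ {S F g} → All (λ s → forbidden s ≡ g) S → g ∉ F →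
    (σ : Injection S F) → Avoiding σ
  avoiding-if-unused S≡g g∉F σ p σp≡ =
    g∉F (subst (_∈ _) (trans σp≡ (All.lookup S≡g p)) (value∈ σ p))

  assign-forced : ∀ {s} S {F} → All (_≡ forbidden s) F → Unique F →
    length (s ∷ S) ≤ length F → Assigned (s ∷ S) F
  assign-forced {s} [] {_ ∷ _} _ _ _ = extend (here refl) empty , inj₂ (forbidden s , refl ∷ [])
  assign-forced (_ ∷ _) {_ ∷ []} _ _ (s≤s ())
  assign-forced (_ ∷ _) {_ ∷ _ ∷ _} (x≡s ∷ y≡s ∷ _) ((x≢y ∷ _) ∷ _) _ =
    ⊥-elim (x≢y (trans x≡s (sym y≡s)))

  -- If the tail is uniform with value g ≠ forbidden s, the head takes g itself
  -- whenever g is available, so that no tail element can be sent to g.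
  assign : ∀ S {F} → Unique F → length S ≤ length F → Assigned S F
  assign [] _ _ = empty , inj₁ (λ ())
  assign (s ∷ S) {F} uF len with all? (_≟ forbidden s) F
  ... | yes F≡s = assign-forced S F≡s uF len
  ... | no F≢s with find (¬All⇒Any¬ (_≟ forbidden s) F F≢s)
  ... | f , f∈F , f≢s with assign S (remove-unique uF) shorter
    where
    shorter : ∀ {f} → length S ≤ length (remove f F)
    shorter = ≤-pred (≤-trans len (length≤suc-remove uF))
  ... | σ , inj₁ σ-avoids = extend f∈F σ , inj₁ (extend-avoiding f∈F f≢s σ-avoids)
  ... | σ , inj₂ (g , S≡g) with forbidden s ≟ g | g ∈? F
  ... | yes s≡g | _ = extend f∈F σ , inj₂ (g , s≡g ∷ S≡g)
  ... | no _ | no g∉F =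
    extend f∈F σ , inj₁ (extend-avoiding f∈F f≢s σ-avoids)
    where
    σ-avoids : Avoiding σ
    σ-avoids = avoiding-if-unused S≡g (g∉F ∘ proj₁ ∘ ∈-remove⁻ F) σ
  ... | no s≢g | yes g∈F =
    extend g∈F σ′ , inj₁ (extend-avoiding g∈F (s≢g ∘ sym) σ′-avoids)
    where
    σ′ : Injection S (remove g F)
    σ′ = proj₁ (assign S (remove-unique uF) (≤-pred (≤-trans len (length≤suc-remove uF))))
    σ′-avoids : Avoiding σ′
    σ′-avoids = avoiding-if-unused S≡g (λ g∈ → proj₂ (∈-remove⁻ F g∈) refl) σ′

module Incidence {Δ k} (T : TD Δ k) where

  _∋_ : Fin (k * k) → Node Δ k → Set
  X ∋ x = block T X (proj₁ x) ≡ proj₂ x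

  nodeOf : Fin (k * k) → Fin Δ → Node Δ k
  nodeOf X g = g , block T X g

  Misses : Fin (k * k) → Fin (k * k) → Set
  Misses X Y = ∀ g → block T X g ≢ block T Y g

  sharing-two-nodes⇒≡ : ∀ {g h X Y} → g ≢ h →
    block T X g ≡ block T Y g → block T X h ≡ block T Y h → X ≡ Y
  sharing-two-nodes⇒≡ {g} {h} {X} {Y} g≢h Xg≡Yg Xh≡Yh =
    pair-unique T g h g≢h _ _ X Y Xg≡Yg Xh≡Yh refl refl

  through : ∀ {g h} → g ≢ h → Fin k → Fin k → Fin (k * k)
  through g≢h a b = proj₁ (pair-exists T _ _ g≢h a b)

  through-∋ˡ : ∀ {g h} (g≢h : g ≢ h) a b → block T (through g≢h a b) g ≡ a
  through-∋ˡ g≢h a b = proj₁ (proj₂ (pair-exists T _ _ g≢h a b))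

  through-∋ʳ : ∀ {g h} (g≢h : g ≢ h) a b → block T (through g≢h a b) h ≡ b
  through-∋ʳ g≢h a b = proj₂ (proj₂ (pair-exists T _ _ g≢h a b))

module _ {m k} (T : TD (suc m) k) where
  open Incidence T

  module _ {U : Fin (k * k)} {g h : Fin (suc m)} {a : Fin k}
           (a∉U : ¬ U ∋ (g , a)) (g≢h : g ≢ h) where

    private
      D : Fin k → Fin (k * k)
      D = through g≢h a

      Meets : Fin k → Set
      Meets b = ∃ λ f → block T (D b) f ≡ block T U f

      meets? : ∀ b → Dec (Meets b)
      meets? b = anyᶠ? (λ f → block T (D b) f ≟ᶠ block T U f)

      meeting-group≢g : ∀ {b} (meets : Meets b) → g ≢ proj₁ meets
      meeting-group≢g {b} (f , Df≡Uf) refl = a∉U (trans (sym Df≡Uf) (through-∋ˡ g≢h a b))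

      not-all-meet : suc m ≤ k → ¬ (∀ b → Meets b)
      not-all-meet m<k meets with pigeonhole m<k (λ b → punchOut (meeting-group≢g (meets b)))
      ... | b₁ , b₂ , b₁<b₂ , same = <ᶠ-irrefl b₁≡b₂ b₁<b₂
        where
        f₁ f₂ : Fin (suc m)
        f₁ = proj₁ (meets b₁)
        f₂ = proj₁ (meets b₂)
        f₁≡f₂ : f₁ ≡ f₂
        f₁≡f₂ = punchOut-injective (meeting-group≢g (meets b₁))
                                   (meeting-group≢g (meets b₂)) same
        D₂f₁≡Uf₁ : block T (D b₂) f₁ ≡ block T U f₁
        D₂f₁≡Uf₁ =
          subst (λ f → block T (D b₂) f ≡ block T U f) (sym f₁≡f₂) (proj₂ (meets b₂))
        D₁≡D₂ : D b₁ ≡ D b₂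
        D₁≡D₂ = sharing-two-nodes⇒≡ (meeting-group≢g (meets b₁))
          (trans (through-∋ˡ g≢h a b₁) (sym (through-∋ˡ g≢h a b₂)))
          (trans (proj₂ (meets b₁)) (sym D₂f₁≡Uf₁))
        b₁≡b₂ : b₁ ≡ b₂
        b₁≡b₂ = begin
          b₁                ≡⟨ sym (through-∋ʳ g≢h a b₁) ⟩
          block T (D b₁) h  ≡⟨ cong (λ X → block T X h) D₁≡D₂ ⟩
          block T (D b₂) h  ≡⟨ through-∋ʳ g≢h a b₂ ⟩
          b₂                ∎
          where open ≡-Reasoning

    block-through-missing : suc m ≤ k → ∃ λ b → Misses (through g≢h a b) U
    block-through-missing m<k with anyᶠ? (λ b → ¬? (meets? b))
    ... | yes (b , ¬meets) = b , λ f Df≡Uf → ¬meets (f , Df≡Uf)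
    ... | no ¬∃ = contradiction all-meet (not-all-meet m<k)
      where
      all-meet : ∀ b → Meets b
      all-meet b = decidable-stable (meets? b) (λ ¬meets → ¬∃ (b , ¬meets))

module _ {Δ k} {T : TD Δ k} where
  open Incidence T

  path₁ : ∀ {U y} → U ∋ y → Path T (inj₂ U) (inj₁ y)
  path₁ U∋y = record { mid = [] ; distinct = ((λ ()) ∷ []) ∷ [] ∷ [] ; adjacent = U∋y ∷ [-] }

  path₃ : ∀ {U B x y} → B ≢ U → x ≢ y →
    U ∋ x → B ∋ x → B ∋ y → Path T (inj₂ U) (inj₁ y)
  path₃ B≢U x≢y U∋x B∋x B∋y = record
    { mid = inj₁ _ ∷ inj₂ _ ∷ []
    ; distinct = ((λ ()) ∷ (B≢U ∘ sym ∘ inj₂-injective) ∷ (λ ()) ∷ [])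
               ∷ ((λ ()) ∷ (x≢y ∘ inj₁-injective) ∷ [])
               ∷ ((λ ()) ∷ [])
               ∷ [] ∷ []
    ; adjacent = U∋x ∷ B∋x ∷ B∋y ∷ [-]
    }

  path₅ : ∀ {U C D x w y} → C ≢ U → D ≢ U → C ≢ D → x ≢ w → x ≢ y → w ≢ y →
    U ∋ x → C ∋ x → C ∋ w → D ∋ w → D ∋ y → Path T (inj₂ U) (inj₁ y)
  path₅ C≢U D≢U C≢D x≢w x≢y w≢y U∋x C∋x C∋w D∋w D∋y = record
    { mid = inj₁ _ ∷ inj₂ _ ∷ inj₁ _ ∷ inj₂ _ ∷ []
    ; distinct = ( (λ ()) ∷ (C≢U ∘ sym ∘ inj₂-injective) ∷ (λ ())
                 ∷ (D≢U ∘ sym ∘ inj₂-injective) ∷ (λ ()) ∷ [])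
               ∷ ((λ ()) ∷ (x≢w ∘ inj₁-injective) ∷ (λ ()) ∷ (x≢y ∘ inj₁-injective) ∷ [])
               ∷ ((λ ()) ∷ (C≢D ∘ inj₂-injective) ∷ (λ ()) ∷ [])
               ∷ ((λ ()) ∷ (w≢y ∘ inj₁-injective) ∷ [])
               ∷ ((λ ()) ∷ [])
               ∷ [] ∷ []
    ; adjacent = U∋x ∷ C∋x ∷ C∋w ∷ D∋w ∷ D∋y ∷ [-]
    }

module Construction {n k} (Δ≤k : 2 + n ≤ k) (T : TD (2 + n) k) (U : Fin (k * k))
                    (t : Fin (2 + n) → Node (2 + n) k) where
  open Incidence T
  open Assignment _≟ᶠ_ (proj₁ ∘ t)
  open Removal (_≟ᶠ_ {2 + n}) using (Unique-⊆⇒length≤)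

  Near : Fin (2 + n) → Set
  Near i = U ∋ t i

  near? : Decidable Near
  near? i = block T U (proj₁ (t i)) ≟ᶠ proj₂ (t i)

  Occupied : Fin (2 + n) → Set
  Occupied g = ∃ λ i → t i ≡ nodeOf U g

  occupied? : Decidable Occupied
  occupied? g = anyᶠ? (λ i → ≡-dec _≟ᶠ_ _≟ᶠ_ (t i) (nodeOf U g))

  near far occupied free : List (Fin (2 + n))
  near = filter near? (allFin _)
  far = filter (∁? near?) (allFin _)
  occupied = filter occupied? (allFin _)
  free = filter (∁? occupied?) (allFin _)

  occupied⊆groups-of-near : occupied ⊆ map (proj₁ ∘ t) near
  occupied⊆groups-of-near g∈occupied with ∈-filter⁻ occupied? g∈occupied
  ... | _ , i , tᵢ≡ = subst (_∈ _) (cong proj₁ tᵢ≡) (∈-map⁺ _ i∈near)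
    where
    i∈near : i ∈ near
    i∈near = ∈-filter⁺ near? (∈-allFin i) (subst (U ∋_) (sym tᵢ≡) refl)

  far≤free : length far ≤ length free
  far≤free = +-cancelˡ-≤ (length occupied) _ _ (begin
    length occupied + length far  ≤⟨ +-monoˡ-≤ (length far) occupied≤near ⟩
    length near + length far      ≡⟨ length-filter-∁ near? (allFin _) ⟩
    length (allFin (2 + n))       ≡⟨ sym (length-filter-∁ occupied? (allFin _)) ⟩
    length occupied + length free ∎)
    where
    open ≤-Reasoning
    occupied≤near : length occupied ≤ length near
    occupied≤near = begin
      length occupied                ≤⟨ Unique-⊆⇒length≤ occupied-unique occupied⊆groups-of-near ⟩
      length (map (proj₁ ∘ t) near)  ≡⟨ length-map _ near ⟩
      length near                    ∎
      where
      occupied-unique : Unique occupied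
      occupied-unique = Unique.filter⁺ occupied? (Unique.allFin⁺ _)

  assignment : Assigned far free
  assignment = assign far (Unique.filter⁺ (∁? occupied?) (Unique.allFin⁺ _)) far≤free

  far∈ : ∀ {i} → ¬ Near i → i ∈ far
  far∈ {i} fi = ∈-filter⁺ (∁? near?) (∈-allFin i) fi

  entry : ∀ {i} → ¬ Near i → Fin (2 + n)
  entry fi = value (proj₁ assignment) (far∈ fi)

  entry-free : ∀ {i} (fi : ¬ Near i) j → t j ≢ nodeOf U (entry fi)
  entry-free fi j tⱼ≡ =
    proj₂ (∈-filter⁻ (∁? occupied?) (value∈ (proj₁ assignment) (far∈ fi))) (j , tⱼ≡)

  entry-injective : ∀ {i j} (fi : ¬ Near i) (fj : ¬ Near j) → entry fi ≡ entry fj → i ≡ j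
  entry-injective fi fj = value-injective (proj₁ assignment) (far∈ fi) (far∈ fj)

  Hard : ∀ {i} → ¬ Near i → Set
  Hard {i} fi = entry fi ≡ proj₁ (t i)

  hard⇒same-group : ∀ {i} (fi : ¬ Near i) → Hard fi →
    ∀ {j} → ¬ Near j → proj₁ (t j) ≡ proj₁ (t i)
  hard⇒same-group fi hard fj with proj₂ assignment
  ... | inj₁ avoiding = ⊥-elim (avoiding (far∈ fi) hard)
  ... | inj₂ (_ , far≡g) = trans (All.lookup far≡g (far∈ fj)) (sym (All.lookup far≡g (far∈ fi)))

  hard-unique : ∀ {i j} (fi : ¬ Near i) (fj : ¬ Near j) → Hard fi → Hard fj → i ≡ j
  hard-unique fi fj hᵢ hⱼ =
    entry-injective fi fj (trans hᵢ (trans (sym (hard⇒same-group fi hᵢ fj)) (sym hⱼ)))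

  data InternalNode (i : Fin (2 + n)) (x : Node (2 + n) k) : Set where
    on-U : (fi : ¬ Near i) → x ≡ nodeOf U (entry fi) → InternalNode i x
    off-U : (fi : ¬ Near i) → Hard fi → ¬ U ∋ x → proj₁ x ≢ proj₁ (t i) → InternalNode i x

  data InternalBlock (i : Fin (2 + n)) (X : Fin (k * k)) : Set where
    meets-U : (fi : ¬ Near i) → X ≢ U →
      block T X (entry fi) ≡ block T U (entry fi) → InternalBlock i X
    misses-U : (fi : ¬ Near i) → Hard fi → Misses X U → InternalBlock i X

  Internal : Fin (2 + n) → Vertex (2 + n) k → Set
  Internal i (inj₁ x) = InternalNode i x
  Internal i (inj₂ X) = InternalBlock i X

  off-U≢target : ∀ {i x} (fi : ¬ Near i) → Hard fi →
    ¬ U ∋ x → proj₁ x ≢ proj₁ (t i) → ∀ j → x ≢ t j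
  off-U≢target fi hard x∉U x∉group j x≡tⱼ with near? j
  ... | yes near = x∉U (subst (U ∋_) (sym x≡tⱼ) near)
  ... | no fj = x∉group (trans (cong proj₁ x≡tⱼ) (hard⇒same-group fi hard fj))

  internal-avoids-ends : ∀ {i} v → Internal i v → ∀ j → v ≢ inj₂ U × v ≢ inj₁ (t j)
  internal-avoids-ends (inj₁ x) (on-U fi x≡) j =
    (λ ()) , λ x≡tⱼ → entry-free fi j (trans (sym (inj₁-injective x≡tⱼ)) x≡)
  internal-avoids-ends (inj₁ x) (off-U fi hard x∉U x∉group) j =
    (λ ()) , off-U≢target fi hard x∉U x∉group j ∘ inj₁-injective
  internal-avoids-ends (inj₂ X) (meets-U _ X≢U _) j = X≢U ∘ inj₂-injective , λ ()
  internal-avoids-ends (inj₂ X) (misses-U _ _ misses) j =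
    (λ X≡U → misses zero (cong (λ Y → block T Y zero) (inj₂-injective X≡U))) , λ ()

  internal-shared : ∀ {i j} v → Internal i v → Internal j v → i ≡ j
  internal-shared (inj₁ x) (on-U fi x≡) (on-U fj x≡′) =
    entry-injective fi fj (cong proj₁ (trans (sym x≡) x≡′))
  internal-shared (inj₁ x) (on-U _ x≡) (off-U _ _ x∉U _) =
    ⊥-elim (x∉U (subst (U ∋_) (sym x≡) refl))
  internal-shared (inj₁ x) (off-U _ _ x∉U _) (on-U _ x≡) =
    ⊥-elim (x∉U (subst (U ∋_) (sym x≡) refl))
  internal-shared (inj₁ x) (off-U fi hᵢ _ _) (off-U fj hⱼ _ _) = hard-unique fi fj hᵢ hⱼ
  internal-shared (inj₂ X) (meets-U fi X≢U mᵢ) (meets-U fj _ mⱼ) with entry fi ≟ᶠ entry fj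
  ... | yes eᵢ≡eⱼ = entry-injective fi fj eᵢ≡eⱼ
  ... | no eᵢ≢eⱼ = ⊥-elim (X≢U (sharing-two-nodes⇒≡ eᵢ≢eⱼ mᵢ mⱼ))
  internal-shared (inj₂ X) (meets-U _ _ m) (misses-U _ _ misses) = ⊥-elim (misses _ m)
  internal-shared (inj₂ X) (misses-U _ _ misses) (meets-U _ _ m) = ⊥-elim (misses _ m)
  internal-shared (inj₂ X) (misses-U fi hᵢ _) (misses-U fj hⱼ _) = hard-unique fi fj hᵢ hⱼ

  record Route (i : Fin (2 + n)) : Set where
    field
      path : Path T (inj₂ U) (inj₁ (t i))
      short : pathLength path ≤ 7
      internal : All (Internal i) (mid path)

  direct-route : ∀ {i} → Near i → Route i
  direct-route near = record { path = path₁ near ; short = m≤m+n 1 6 ; internal = [] }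

  easy-route : ∀ {i} (fi : ¬ Near i) → entry fi ≢ proj₁ (t i) → Route i
  easy-route {i} fi e≢g = record
    { path = path₃ B≢U (entry-free fi i ∘ sym) refl B∋u B∋t
    ; short = m≤m+n 3 4
    ; internal = on-U fi refl ∷ meets-U fi B≢U B∋u ∷ []
    }
    where
    B : Fin (k * k)
    B = through e≢g (block T U (entry fi)) (proj₂ (t i))
    B∋u : B ∋ nodeOf U (entry fi)
    B∋u = through-∋ˡ e≢g _ _
    B∋t : B ∋ t i
    B∋t = through-∋ʳ e≢g _ _
    B≢U : B ≢ U
    B≢U B≡U = fi (subst (_∋ t i) B≡U B∋t)

  hard-route : ∀ {i} (fi : ¬ Near i) → Hard fi → Route i
  hard-route {i} fi hard = record
    { path = path₅ C≢U D≢U C≢D u≢w (entry-free fi i ∘ sym) w≢t refl C∋u C∋w D∋w D∋t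
    ; short = m≤m+n 5 2
    ; internal = on-U fi refl ∷ meets-U fi C≢U C∋u ∷ off-U fi hard w∉U h≢g
               ∷ misses-U fi hard D-misses-U ∷ []
    }
    where
    g h : Fin (2 + n)
    g = proj₁ (t i)
    h = punchIn g zero
    h≢g : h ≢ g
    h≢g = punchInᵢ≢i g zero
    e≢h : entry fi ≢ h
    e≢h e≡h = h≢g (trans (sym e≡h) hard)
    b : Fin k
    b = proj₁ (block-through-missing T fi (h≢g ∘ sym) Δ≤k)
    w : Node (2 + n) k
    w = h , b
    C D : Fin (k * k)
    C = through e≢h (block T U (entry fi)) b
    D = through (h≢g ∘ sym) (proj₂ (t i)) b
    D-misses-U : Misses D U
    D-misses-U = proj₂ (block-through-missing T fi (h≢g ∘ sym) Δ≤k)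
    C∋u : C ∋ nodeOf U (entry fi)
    C∋u = through-∋ˡ e≢h _ _
    C∋w : C ∋ w
    C∋w = through-∋ʳ e≢h _ _
    D∋t : D ∋ t i
    D∋t = through-∋ˡ (h≢g ∘ sym) _ _
    D∋w : D ∋ w
    D∋w = through-∋ʳ (h≢g ∘ sym) _ _
    w∉U : ¬ U ∋ w
    w∉U U∋w = D-misses-U h (trans D∋w (sym U∋w))
    C≢U : C ≢ U
    C≢U C≡U = w∉U (subst (_∋ w) C≡U C∋w)
    D≢U : D ≢ U
    D≢U D≡U = D-misses-U h (cong (λ Y → block T Y h) D≡U)
    C≢D : C ≢ D
    C≢D C≡D = D-misses-U (entry fi)
      (subst (λ Y → block T Y (entry fi) ≡ block T U (entry fi)) C≡D C∋u)
    u≢w : nodeOf U (entry fi) ≢ w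
    u≢w u≡w = w∉U (subst (U ∋_) u≡w refl)
    w≢t : w ≢ t i
    w≢t w≡t = h≢g (cong proj₁ w≡t)

  route : ∀ i → Route i
  route i with near? i
  ... | yes near = direct-route near
  ... | no fi with entry fi ≟ᶠ proj₁ (t i)
  ...   | yes hard = hard-route fi hard
  ...   | no e≢g = easy-route fi e≢g

corollary1 : (k Δ : ℕ) → 2 ≤ k → 2 ≤ Δ → Δ ≤ k →
    (T : TD Δ k) → (U : Fin (k * k)) → (t : Fin Δ → Node Δ k) →
    Σ ((i : Fin Δ) → Path T (inj₂ U) (inj₁ (t i))) (λ π →
    (∀ i → pathLength (π i) ≤ 7)
    × InternallyDisjoint (λ _ → inj₂ U) (λ i → inj₁ (t i)) π)
corollary1 k _ _ (s≤s (s≤s _)) Δ≤k T U t =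
  path ∘ route , short ∘ route , avoids-ends , disjoint
  where
  open Construction Δ≤k T U t
  open Route

  internal∈ : ∀ i {v} → v ∈ mid (path (route i)) → Internal i v
  internal∈ i = All.lookup (internal (route i))

  avoids-ends : ∀ i j v → v ∈ mid (path (route j)) → v ≢ inj₂ U × v ≢ inj₁ (t i)
  avoids-ends i j v v∈πⱼ = internal-avoids-ends v (internal∈ j v∈πⱼ) i

  disjoint : ∀ i j → i ≢ j → ∀ v → v ∈ mid (path (route i)) → v ∈ mid (path (route j)) → ⊥
  disjoint i j i≢j v v∈πᵢ v∈πⱼ =
    i≢j (internal-shared v (internal∈ i v∈πᵢ) (internal∈ j v∈πⱼ))
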